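{- Consider the following algorithm on a properly vertex-colored digraph $(\vec G=(V,E),\sigma)$ with $V\neq\emptyset$: initialize $\vec G^*\leftarrow\vec G$; call $\mathrm{Edit}(V)$, where $\mathrm{Edit}(V')$ does the following: if $|V'|>1$, choose a bipartition $\mathscr V$ of $V'$, replace $\vec G^*$ by $\vec G^*\triangle U(\vec G^*[V'],\mathscr V)$ (computed for the current $\vec G^*$), and call $\mathrm{Edit}(V_i)$ for each $V_i\in\mathscr V$; if $|V'|=1$, do nothing; finally output $(\vec G^*,\sigma)$. Suppose that in each step on $V'$ with $|V'|\ge 2$ the bipartition $\mathscr V$ is chosen according to one of the following rules (with $\vec G^*$ the current graph at the start of the step): (1) $\mathscr V$ has minimal UR-cost $c(\vec G^*[V'],\mathscr V)$ among all bipartitions of $V'$; (2) if the Aho graph $[\mathscr R^{\mathrm B}(\vec G^*[V'],\sigma_{|V'}),V']$ is disconnected with set of connected components $\mathscr V_{\mathrm{Aho}}$ and moreover $c(\vec G^*[V'],\mathscr V_{\mathrm{Aho}})=0$, then $\mathscr V$ is a coarse-graining of $\mathscr V_{\mathrm{Aho}}$. Then the algorithm is consistent for binary-explainable best match graphs: whenever $(\vec G,\sigma)$ is a binary-explainable best match graph, the output equals $(\vec G,\sigma)$.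
   Context: A digraph $\vec G=(V,E)$ has a finite vertex set and arc set $E\subseteq (V\times V)\setminus\{(v,v)\mid v\in V\}$; $\vec G\triangle F=(V,E\triangle F)$; $\vec G[W]$ is the induced subgraph, colored by $\sigma_{|W}$. A vertex coloring is proper if adjacent vertices have distinct colors. A bipartition is a partition into exactly two non-empty sets; a partition $\mathscr V'$ is a coarse-graining of $\mathscr V$ if every set of $\mathscr V$ is contained in some set of $\mathscr V'$. All rooted trees are phylogenetic (every non-leaf vertex has at least two children); binary means every non-leaf vertex has exactly two children; $L(T)$ is the leaf set, $\rho_T$ the root, $T(v)$ the subtree rooted at $v$, $\mathrm{child}_T(v)$ the children of $v$; $u\preceq_T v$ means $v$ lies on the path from $u$ to the root; $\mathrm{lca}_T$ is the last common ancestor. For a tree $T$ with leaf coloring $\sigma$, a leaf $y$ is a best match of a leaf $x$ if $\sigma(x)\ne\sigma(y)$ and $\mathrm{lca}_T(x,y)\preceq_T\mathrm{lca}_T(x,y')$ for all leaves $y'$ with $\sigma(y')=\sigma(y)$; the best match graph $\vec G(T,\sigma)$ has vertex set $L(T)$, coloring $\sigma$, and arcs $(x,y)$ whenever $y$ is a best match of $x$. A properly colored digraph is a binary-explainable best match graph if it equals $\vec G(T,\sigma)$ for some binary tree $T$. For a colored digraph $(\vec H=(W,E_H),\tau)$: $\mathscr R(\vec H,\tau)=\{ab|b'\colon \tau(a)\ne\tau(b)=\tau(b'),\ (a,b)\in E_H,\ (a,b')\notin E_H\}$, $\mathscr F(\vec H,\tau)=\{ab|b'\colon \tau(a)\ne\tau(b)=\tau(b'),\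 b\ne b',\ (a,b),(a,b')\in E_H\}$, $\mathscr R^{\mathrm B}(\vec H,\tau)=\mathscr R(\vec H,\tau)\cup\{bb'|a\colon ab|b'\in\mathscr F(\vec H,\tau)\}$; for a triple set $\mathscr R$ the Aho graph $[\mathscr R,W]$ is the undirected graph on $W$ with edge $xy$ iff $xy|z\in\mathscr R$ for some $z\in W$; for a tree $T$ with $L(T)=W$, $U(\vec H,T)=E_H\triangle E(\vec G(T,\tau))$; for a partition $\mathscr W$ of $W$ with $|\mathscr W|\ge 2$, $\mathscr T(\mathscr W)$ is the set of phylogenetic trees $T$ with $L(T)=W$ and $\{L(T(v))\mid v\in\mathrm{child}_T(\rho_T)\}=\mathscr W$, $U(\vec H,\mathscr W)=\bigcap_{T\in\mathscr T(\mathscr W)}U(\vec H,T)$, and the UR-cost is $c(\vec H,\mathscr W)=|U(\vec H,\mathscr W)|$. -}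

module Defs where

open import Data.Nat using (ℕ; _≤_; _<_)
open import Data.Bool using (Bool; true; false; not)
open import Data.Fin using (Fin)
open import Data.Fin.Subset using (Subset; _∈_; _⊆_; _∩_; _∪_; ⊥; Nonempty; ∣_∣)
open import Data.List using (List; []; _∷_; length; concatMap)
open import Data.List.Relation.Unary.All using (All)
open import Data.List.Relation.Unary.Unique.Propositional using (Unique)
import Data.List.Membership.Propositional as LM
open import Data.Product using (Σ; ∃; _×_; _,_)
open import Data.Sum using (_⊎_)
open import Relation.Nullary using (¬_)
open import Relation.Binary.PropositionalEquality using (_≡_; _≢_)
open import Relation.Binary.Construct.Closure.ReflexiveTransitive using (Star)
open import Function.Bundles using (_⇔_)

Graph : ℕ → Set
Graph n = Fin n → Fin n → Bool

Colouring : ℕ → Set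
Colouring n = Fin n → ℕ

module _ {n : ℕ} where

  Irreflexive : Graph n → Set
  Irreflexive G = ∀ v → G v v ≡ false

  ProperlyColoured : Graph n → Colouring n → Set
  ProperlyColoured G σ = ∀ x y → G x y ≡ true → σ x ≢ σ y

data Tree (A : Set) : Set where
  leaf : A → Tree A
  node : List (Tree A) → Tree A

module _ {A : Set} where

  leaves : Tree A → List A
  leavesL : List (Tree A) → List A
  leaves (leaf a) = a ∷ []
  leaves (node ts) = leavesL ts
  leavesL [] = []
  leavesL (t ∷ ts) = Data.List._++_ (leaves t) (leavesL ts)

  children : Tree A → List (Tree A)
  children (leaf _) = []
  children (node ts) = ts

  data Phylo : Tree A → Set where
    leafP : ∀ {a} → Phylo (leaf a)
    nodeP : ∀ {ts} → 2 ≤ length ts → All Phylo ts → Phylo (node ts)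

  data Binary : Tree A → Set where
    leafB : ∀ {a} → Binary (leaf a)
    nodeB : ∀ {ts} → length ts ≡ 2 → All Binary ts → Binary (node ts)

  -- For trees with pairwise distinct leaf labels a vertex
  -- v of T is identified with the subtree T(v), and u ⪯_T v iff T(u) ≼ T(v).
  data _≼_ : Tree A → Tree A → Set where
    ≼-refl  : ∀ {t} → t ≼ t
    ≼-child : ∀ {s t ts} → s ≼ t → t LM.∈ ts → s ≼ node ts

module _ {n : ℕ} where

  LeafSetIs : Tree (Fin n) → Subset n → Set
  LeafSetIs t W = ∀ x → (x ∈ W) ⇔ (x LM.∈ leaves t)

  ValidTree : Subset n → Tree (Fin n) → Set
  ValidTree W T = Phylo T × Unique (leaves T) × LeafSetIs T W

  IsLca : Tree (Fin n) → Tree (Fin n) → Fin n → Fin n → Set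
  IsLca T v x y =
    v ≼ T × x LM.∈ leaves v × y LM.∈ leaves v ×
    (∀ w → w ≼ T → x LM.∈ leaves w → y LM.∈ leaves w → v ≼ w)

  BestMatch : Colouring n → Tree (Fin n) → Fin n → Fin n → Set
  BestMatch σ T x y =
    x LM.∈ leaves T × y LM.∈ leaves T × σ x ≢ σ y ×
    (∀ y' → y' LM.∈ leaves T → σ y' ≡ σ y →
      ∀ u v → IsLca T u x y → IsLca T v x y' → u ≼ v)

  BinaryExplainableBMG : Graph n → Colouring n → Set
  BinaryExplainableBMG G σ =
    Σ (Tree (Fin n)) λ T → ValidTree Data.Fin.Subset.⊤ T × Binary T ×
      (∀ x y → (G x y ≡ true) ⇔ BestMatch σ T x y)

  InTW : Subset n → List (Subset n) → Tree (Fin n) → Set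
  InTW W 𝒲 T =
    ValidTree W T ×
    All (λ t → ∃ λ P → P LM.∈ 𝒲 × LeafSetIs t P) (children T) ×
    All (λ P → ∃ λ t → t LM.∈ children T × LeafSetIs t P) 𝒲

  UT : Colouring n → Graph n → Subset n → Tree (Fin n) → Fin n → Fin n → Set
  UT σ G W T a b =
    (G a b ≡ true × ¬ BestMatch σ T a b) ⊎ (G a b ≡ false × BestMatch σ T a b)

  UW : Colouring n → Graph n → Subset n → List (Subset n) → Fin n → Fin n → Set
  UW σ G W 𝒲 a b = a ∈ W × b ∈ W × (∀ T → InTW W 𝒲 T → UT σ G W T a b)

  HasCost : Colouring n → Graph n → Subset n → List (Subset n) → ℕ → Set
  HasCost σ G W 𝒲 k =
    Σ (List (Fin n × Fin n)) λ l → Unique l × length l ≡ k ×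
      (∀ a b → ((a , b) LM.∈ l) ⇔ UW σ G W 𝒲 a b)

  IsBipartition : Subset n → Subset n → Subset n → Set
  IsBipartition W A B = Nonempty A × Nonempty B × A ∩ B ≡ ⊥ × A ∪ B ≡ W

  IsPartition : Subset n → List (Subset n) → Set
  IsPartition W 𝒫 =
    All (λ P → Nonempty P × P ⊆ W) 𝒫 ×
    (∀ x → x ∈ W → ∃ λ P → P LM.∈ 𝒫 × x ∈ P) ×
    (∀ P Q x → P LM.∈ 𝒫 → Q LM.∈ 𝒫 → x ∈ P → x ∈ Q → P ≡ Q)

  -- Informative triples of (G[W] , σ|W);  R a b c  means the triple ab|c.

  RTriple : Colouring n → Graph n → Subset n → Fin n → Fin n → Fin n → Set
  RTriple σ G W a b b' =
    a ∈ W × b ∈ W × b' ∈ W × σ a ≢ σ b × σ b ≡ σ b' ×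
    G a b ≡ true × G a b' ≡ false

  FTriple : Colouring n → Graph n → Subset n → Fin n → Fin n → Fin n → Set
  FTriple σ G W a b b' =
    a ∈ W × b ∈ W × b' ∈ W × σ a ≢ σ b × σ b ≡ σ b' × b ≢ b' ×
    G a b ≡ true × G a b' ≡ true

  -- R^B = R ∪ { bb'|a : ab|b' ∈ F }
  RBTriple : Colouring n → Graph n → Subset n → Fin n → Fin n → Fin n → Set
  RBTriple σ G W x y z = RTriple σ G W x y z ⊎ FTriple σ G W z x y

  -- edge xy of the Aho graph [R^B , W]  (xy|z = yx|z)
  AhoEdge : Colouring n → Graph n → Subset n → Fin n → Fin n → Set
  AhoEdge σ G W x y =
    x ∈ W × y ∈ W × ∃ λ z → z ∈ W × (RBTriple σ G W x y z ⊎ RBTriple σ G W y x z)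

  AhoConnected : Colouring n → Graph n → Subset n → Fin n → Fin n → Set
  AhoConnected σ G W = Star (AhoEdge σ G W)

  IsAhoComponents : Colouring n → Graph n → Subset n → List (Subset n) → Set
  IsAhoComponents σ G W 𝒫 =
    IsPartition W 𝒫 ×
    (∀ x y → x ∈ W → y ∈ W →
      (∃ λ P → P LM.∈ 𝒫 × x ∈ P × y ∈ P) ⇔ AhoConnected σ G W x y)

  AhoDisconnected : Colouring n → Graph n → Subset n → Set
  AhoDisconnected σ G W =
    ∃ λ x → ∃ λ y → x ∈ W × y ∈ W × ¬ AhoConnected σ G W x y

  Rule1 : Colouring n → Graph n → Subset n → Subset n → Subset n → Set
  Rule1 σ G W A B =
    Σ ℕ λ k → HasCost σ G W (A ∷ B ∷ []) k ×
      (∀ A' B' → IsBipartition W A' B' → ∀ k' →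
         HasCost σ G W (A' ∷ B' ∷ []) k' → k ≤ k')

  Rule2 : Colouring n → Graph n → Subset n → Subset n → Subset n → Set
  Rule2 σ G W A B =
    AhoDisconnected σ G W ×
    ∃ λ 𝒱Aho → IsAhoComponents σ G W 𝒱Aho × HasCost σ G W 𝒱Aho 0 ×
      All (λ P → P ⊆ A ⊎ P ⊆ B) 𝒱Aho

  EditStep : Colouring n → Graph n → Subset n → List (Subset n) → Graph n → Set
  EditStep σ G W 𝒲 G' =
    ∀ a b → (UW σ G W 𝒲 a b → G' a b ≡ not (G a b)) ×
            (¬ UW σ G W 𝒲 a b → G' a b ≡ G a b)

  -- Run σ G W G' : a run of Edit(W) following the rules, starting with
  -- current graph G* = G and ending with current graph G* = G'.
  data Run (σ : Colouring n) : Graph n → Subset n → Graph n → Set where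
    run-one   : ∀ {G W} → ∣ W ∣ ≡ 1 → Run σ G W G
    run-split : ∀ {G W A B G₁ G₂ G₃} →
                1 < ∣ W ∣ →
                IsBipartition W A B →
                (Rule1 σ G W A B ⊎ Rule2 σ G W A B) →
                EditStep σ G W (A ∷ B ∷ []) G₁ →
                Run σ G₁ A G₂ →
                Run σ G₂ B G₃ →
                Run σ G W G₃

-- Invariant: whenever Edit(W) is called, the current graph agrees with G and G[W] is explained
-- by a binary tree with leaf set W (a restriction of the given tree).  The chosen bipartition
-- {A , B} then has UR-cost 0: under rule (1) because the root split of that tree has cost 0,
-- under rule (2) by hypothesis.  Cost 0 pins down the arcs between the parts: for a ∈ A, b ∈ B,
-- a → b iff σ a ≠ σ b and the colour σ b does not occur in A (under rule (2) Aho connectivity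
-- lifts this from the component of a to all of A).  Hence the restrictions T|A and T|B explain
-- G on A and B, and joining them under a new root gives a tree of 𝒯({A , B}) explaining G on W;
-- so U(G[W] , {A , B}) = ∅ and the edit step changes nothing.
module Submission where

open import Data.Bool using (true)
open import Data.Bool.Properties using (¬-not) renaming (_≟_ to _≟ᵇ_)
open import Data.Empty using (⊥; ⊥-elim)
open import Data.Fin using (Fin) renaming (_≟_ to _≟ᶠ_)
import Data.Fin.Properties as Finₚ
open import Data.Fin.Subset using (Subset; Nonempty; ⁅_⁆; _∪_; _∩_; ⊤)
  renaming (_∈_ to _∈ₛ_; _∉_ to _∉ₛ_; _⊆_ to _⊆ₛ_)
import Data.Fin.Subset.Properties as Subsetₚ
open Subsetₚ using () renaming (_∈?_ to _∈ₛ?_)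
open import Data.List using (List; []; _∷_; _++_)
open import Data.List.Properties using (++-identityʳ)
open import Data.List.Membership.Propositional using (_∈_; _∉_; find; lose)
open import Data.List.Membership.Propositional.Properties using (∈-++⁺ˡ; ∈-++⁺ʳ; ∈-++⁻)
import Data.List.Membership.DecPropositional as DecMembership
open import Data.List.Relation.Binary.Disjoint.Propositional using (Disjoint)
open import Data.List.Relation.Binary.Subset.Propositional using (_⊆_)
open import Data.List.Relation.Unary.All as All using (All; []; _∷_)
import Data.List.Relation.Unary.All.Properties as Allₚ
open import Data.List.Relation.Unary.Any using (here; there; any?)
open import Data.List.Relation.Unary.Unique.Propositional using (Unique; []; _∷_)
import Data.List.Relation.Unary.Unique.Propositional.Properties as Uniqueₚ
open import Data.Nat using (ℕ; _<_; z≤n; s≤s; _≟_)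
open import Data.Nat.Properties using (n≤0⇒n≡0)
open import Data.Product using (Σ; ∃; ∃₂; _×_; _,_; proj₁; proj₂)
open import Data.Sum as Sum using (_⊎_; inj₁; inj₂; [_,_]′)
open import Function.Base using (_∘_; _$_)
open import Function.Bundles using (_⇔_; mk⇔; Equivalence)
import Function.Properties.Equivalence as ⇔
open import Relation.Binary.Construct.Closure.ReflexiveTransitive using (ε; _◅_)
open import Relation.Binary.PropositionalEquality using (_≡_; _≢_; refl; sym; trans; subst)
open import Relation.Nullary using (¬_; yes; no)
open import Relation.Nullary.Decidable using (_×-dec_)

open import Defs

open Equivalence using (to; from)

module _ {n : ℕ} where

  open DecMembership (_≟ᶠ_ {n}) using (_∈?_)

  private
    variable
      x y y' z a : Fin n
      s t u c c' : Tree (Fin n)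
      ts ts' : List (Tree (Fin n))

  ≼-trans : s ≼ t → t ≼ u → s ≼ u
  ≼-trans p ≼-refl = p
  ≼-trans p (≼-child q m) = ≼-child (≼-trans p q) m

  ≼-inv : s ≼ t → s ≡ t ⊎ ∃ λ c → c ∈ children t × s ≼ c
  ≼-inv ≼-refl = inj₁ refl
  ≼-inv (≼-child p m) = inj₂ (_ , m , p)

  ≼-leaf : s ≼ leaf a → s ≡ leaf a
  ≼-leaf ≼-refl = refl

  ∈-leavesL⁺ : c ∈ ts → x ∈ leaves c → x ∈ leavesL ts
  ∈-leavesL⁺ (here refl) x∈c = ∈-++⁺ˡ x∈c
  ∈-leavesL⁺ {ts = t ∷ _} (there c∈ts) x∈c = ∈-++⁺ʳ (leaves t) (∈-leavesL⁺ c∈ts x∈c)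

  ∈-leavesL⁻ : ∀ ts → x ∈ leavesL ts → ∃ λ c → c ∈ ts × x ∈ leaves c
  ∈-leavesL⁻ (t ∷ ts) x∈ts with ∈-++⁻ (leaves t) x∈ts
  ... | inj₁ x∈t = t , here refl , x∈t
  ... | inj₂ x∈ts' with ∈-leavesL⁻ ts x∈ts'
  ...   | c , c∈ts , x∈c = c , there c∈ts , x∈c

  ≼-leaves : s ≼ t → x ∈ leaves s → x ∈ leaves t
  ≼-leaves ≼-refl x∈s = x∈s
  ≼-leaves (≼-child p c∈ts) x∈s = ∈-leavesL⁺ c∈ts (≼-leaves p x∈s)

  Unique-++⁻ : ∀ xs {ys : List (Fin n)} → Unique (xs ++ ys) →
               Unique xs × Unique ys × Disjoint xs ys
  Unique-++⁻ [] u = [] , u , λ ()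
  Unique-++⁻ (x ∷ xs) (x∉ ∷ u) with Unique-++⁻ xs u
  ... | uxs , uys , disj = Allₚ.++⁻ˡ xs x∉ ∷ uxs , uys , λ where
    (here refl , x∈ys) → All.lookup (Allₚ.++⁻ʳ xs x∉) x∈ys refl
    (there v∈xs , v∈ys) → disj (v∈xs , v∈ys)

  Unique-child : Unique (leavesL ts) → c ∈ ts → Unique (leaves c)
  Unique-child {ts = t ∷ _} U c∈ts with Unique-++⁻ (leaves t) U | c∈ts
  ... | Ut , _ , _ | here refl = Ut
  ... | _ , Uts , _ | there c∈ts' = Unique-child Uts c∈ts'

  child-unique : Unique (leavesL ts) → c ∈ ts → c' ∈ ts →
                 x ∈ leaves c → x ∈ leaves c' → c ≡ c'
  child-unique {ts = t ∷ _} U c∈ts c'∈ts x∈c x∈c' with Unique-++⁻ (leaves t) U | c∈ts | c'∈ts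
  ... | _ , _ , _ | here refl | here refl = refl
  ... | _ , _ , t#ts | here refl | there c'∈ts' = ⊥-elim (t#ts (x∈c , ∈-leavesL⁺ c'∈ts' x∈c'))
  ... | _ , _ , t#ts | there c∈ts' | here refl = ⊥-elim (t#ts (x∈c' , ∈-leavesL⁺ c∈ts' x∈c))
  ... | _ , Uts , _ | there c∈ts' | there c'∈ts' = child-unique Uts c∈ts' c'∈ts' x∈c x∈c'

  child-separated⇒root : Unique (leavesL ts) → c ∈ ts → x ∈ leaves c → y ∉ leaves c →
                         s ≼ node ts → x ∈ leaves s → y ∈ leaves s → s ≡ node ts
  child-separated⇒root U c∈ts x∈c y∉c s≼ x∈s y∈s with ≼-inv s≼
  ... | inj₁ s≡root = s≡root
  ... | inj₂ (c' , c'∈ts , s≼c') with child-unique U c∈ts c'∈ts x∈c (≼-leaves s≼c' x∈s)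
  ...   | refl = ⊥-elim (y∉c (≼-leaves s≼c' y∈s))

  IsLca-child⁻ : c ∈ ts → x ∈ leaves c → y ∈ leaves c →
                 IsLca (node ts) u x y → IsLca c u x y
  IsLca-child⁻ c∈ts x∈c y∈c (_ , x∈u , y∈u , least) =
    least _ (≼-child ≼-refl c∈ts) x∈c y∈c , x∈u , y∈u ,
    λ w w≼c → least w (≼-child w≼c c∈ts)

  IsLca-child⁺ : Unique (leavesL ts) → c ∈ ts → IsLca c u x y → IsLca (node ts) u x y
  IsLca-child⁺ {ts = ts} {u = u} {x = x} {y = y} U c∈ts (u≼c , x∈u , y∈u , least) =
    ≼-child u≼c c∈ts , x∈u , y∈u , least'
    where
    least' : ∀ w → w ≼ node ts → x ∈ leaves w → y ∈ leaves w → u ≼ w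
    least' w w≼ x∈w y∈w with ≼-inv w≼
    ... | inj₁ refl = ≼-child u≼c c∈ts
    ... | inj₂ (c' , c'∈ts , w≼c')
          with child-unique U c∈ts c'∈ts (≼-leaves u≼c x∈u) (≼-leaves w≼c' x∈w)
    ...   | refl = least w w≼c' x∈w y∈w

  IsLca-root : Unique (leavesL ts) → c ∈ ts → x ∈ leaves c → y ∈ leavesL ts →
               y ∉ leaves c → IsLca (node ts) (node ts) x y
  IsLca-root U c∈ts x∈c y∈ts y∉c =
    ≼-refl , ∈-leavesL⁺ c∈ts x∈c , y∈ts ,
    λ w w≼ x∈w y∈w → subst (_≼ w) (child-separated⇒root U c∈ts x∈c y∉c w≼ x∈w y∈w) ≼-refl

  IsLca⇒root : Unique (leavesL ts) → c ∈ ts → x ∈ leaves c → y ∉ leaves c →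
               IsLca (node ts) u x y → u ≡ node ts
  IsLca⇒root U c∈ts x∈c y∉c (u≼ , x∈u , y∈u , _) = child-separated⇒root U c∈ts x∈c y∉c u≼ x∈u y∈u

  module _ {x y : Fin n} where

    mutual
      lca : ∀ t → Unique (leaves t) → x ∈ leaves t → y ∈ leaves t → ∃ λ v → IsLca t v x y
      lca (leaf a) _ (here refl) (here refl) =
        leaf a , ≼-refl , here refl , here refl ,
        λ w w≼ _ _ → subst (_≼ w) (≼-leaf w≼) ≼-refl
      lca (node ts) U x∈ts y∈ts with shared-child ts U
      ... | inj₁ (c , v , c∈ts , v-lca) = v , IsLca-child⁺ U c∈ts v-lca
      ... | inj₂ no-shared = node ts , ≼-refl , x∈ts , y∈ts , least
        where
        least : ∀ w → w ≼ node ts → x ∈ leaves w → y ∈ leaves w → node ts ≼ w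
        least w w≼ x∈w y∈w with ≼-inv w≼
        ... | inj₁ refl = ≼-refl
        ... | inj₂ (c , c∈ts , w≼c) =
          ⊥-elim (no-shared c c∈ts (≼-leaves w≼c x∈w) (≼-leaves w≼c y∈w))

      shared-child : ∀ ts → Unique (leavesL ts) →
                     (∃₂ λ c v → c ∈ ts × IsLca c v x y) ⊎ (∀ c → c ∈ ts → x ∈ leaves c → y ∈ leaves c → ⊥)
      shared-child [] _ = inj₂ λ _ ()
      shared-child (t ∷ ts) U with Unique-++⁻ (leaves t) U | x ∈? leaves t ×-dec y ∈? leaves t
      ... | Ut , _ , _ | yes (x∈t , y∈t) =
        let v , v-lca = lca t Ut x∈t y∈t in inj₁ (t , v , here refl , v-lca)
      ... | _ , Uts , _ | no ¬both with shared-child ts Uts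
      ...   | inj₁ (c , v , c∈ts , v-lca) = inj₁ (c , v , there c∈ts , v-lca)
      ...   | inj₂ none = inj₂ λ where
        c (here refl) x∈c y∈c → ¬both (x∈c , y∈c)
        c (there c∈ts) → none c c∈ts

  LcaBelow : Tree (Fin n) → Fin n → Fin n → Fin n → Set
  LcaBelow T x y y' = ∀ u v → IsLca T u x y → IsLca T v x y' → u ≼ v

  LcaBelow-leaf : LcaBelow (leaf a) x y y'
  LcaBelow-leaf u v (u≼ , _) (v≼ , _) rewrite ≼-leaf u≼ | ≼-leaf v≼ = ≼-refl

  LcaBelow-trans : Unique (leaves t) → x ∈ leaves t → z ∈ leaves t →
                   LcaBelow t x y z → LcaBelow t x z y' → LcaBelow t x y y'
  LcaBelow-trans {t = t} U x∈t z∈t y≤z z≤y' u v u-lca v-lca =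
    let w , w-lca = lca t U x∈t z∈t in ≼-trans (y≤z u w u-lca w-lca) (z≤y' w v w-lca v-lca)

  module _ (U : Unique (leavesL ts)) (c∈ts : c ∈ ts) (x∈c : x ∈ leaves c) where

    LcaBelow-child : y ∈ leaves c → y' ∈ leaves c →
                     LcaBelow (node ts) x y y' ⇔ LcaBelow c x y y'
    LcaBelow-child y∈c y'∈c = mk⇔
      (λ below u v u-lca v-lca → below u v (IsLca-child⁺ U c∈ts u-lca) (IsLca-child⁺ U c∈ts v-lca))
      (λ below u v u-lca v-lca →
        below u v (IsLca-child⁻ c∈ts x∈c y∈c u-lca) (IsLca-child⁻ c∈ts x∈c y'∈c v-lca))

    LcaBelow-outside : y' ∉ leaves c → LcaBelow (node ts) x y y'
    LcaBelow-outside y'∉c u v (u≼ , _) v-lca =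
      subst (u ≼_) (sym (IsLca⇒root U c∈ts x∈c y'∉c v-lca)) u≼

    ¬LcaBelow-inside : y ∈ leavesL ts → y ∉ leaves c → y' ∈ leaves c →
                       ¬ LcaBelow (node ts) x y y'
    ¬LcaBelow-inside y∈ts y∉c y'∈c below =
      let v , v-lca = lca c (Unique-child U c∈ts) x∈c y'∈c
          root≼v = below (node ts) v (IsLca-root U c∈ts x∈c y∈ts y∉c) (IsLca-child⁺ U c∈ts v-lca)
      in y∉c (≼-leaves (proj₁ v-lca) (≼-leaves root≼v y∈ts))

    BestMatch-child : (σ : Colouring n) → y ∈ leaves c →
                      BestMatch σ (node ts) x y ⇔ BestMatch σ c x y
    BestMatch-child {y = y} σ y∈c = mk⇔
      (λ (_ , _ , σx≢σy , closest) → x∈c , y∈c , σx≢σy ,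
        λ y' y'∈c σy'≡σy → to (LcaBelow-child y∈c y'∈c) (closest y' (∈-leavesL⁺ c∈ts y'∈c) σy'≡σy))
      (λ (_ , _ , σx≢σy , closest) → ∈-leavesL⁺ c∈ts x∈c , ∈-leavesL⁺ c∈ts y∈c , σx≢σy ,
        closest-in-node closest)
      where
      closest-in-node : (∀ y' → y' ∈ leaves c → σ y' ≡ σ y → LcaBelow c x y y') →
                        ∀ y' → y' ∈ leavesL ts → σ y' ≡ σ y → LcaBelow (node ts) x y y'
      closest-in-node closest y' _ σy'≡σy with y' ∈? leaves c
      ... | yes y'∈c = from (LcaBelow-child y∈c y'∈c) (closest y' y'∈c σy'≡σy)
      ... | no y'∉c = LcaBelow-outside y'∉c

    BestMatch-cross : (σ : Colouring n) → y ∈ leavesL ts → y ∉ leaves c →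
                      BestMatch σ (node ts) x y ⇔
                      (σ x ≢ σ y × ∀ y' → y' ∈ leaves c → σ y' ≢ σ y)
    BestMatch-cross σ y∈ts y∉c = mk⇔
      (λ (_ , _ , σx≢σy , closest) → σx≢σy ,
        λ y' y'∈c σy'≡σy → ¬LcaBelow-inside y∈ts y∉c y'∈c (closest y' (∈-leavesL⁺ c∈ts y'∈c) σy'≡σy))
      (λ (σx≢σy , colour-absent) → ∈-leavesL⁺ c∈ts x∈c , y∈ts , σx≢σy ,
        λ y' _ σy'≡σy → LcaBelow-outside (λ y'∈c → colour-absent y' y'∈c σy'≡σy))

  LcaBelow-node-agree :
    Unique (leavesL ts) → Unique (leavesL ts') → c ∈ ts → c' ∈ ts' → x ∈ leaves c' →
    leavesL ts' ⊆ leavesL ts → leaves c' ⊆ leaves c →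
    (∀ {z} → z ∈ leavesL ts' → z ∉ leaves c' → z ∉ leaves c) →
    (∀ {y y'} → y ∈ leaves c' → y' ∈ leaves c' → LcaBelow c' x y y' ⇔ LcaBelow c x y y') →
    y ∈ leavesL ts' → y' ∈ leavesL ts' →
    LcaBelow (node ts') x y y' ⇔ LcaBelow (node ts) x y y'
  LcaBelow-node-agree {c = c} {c' = c'} {y = y} {y' = y'}
    U U' c∈ts c'∈ts' x∈c' ts'⊆ts c'⊆c outside-c' agree y∈ts' y'∈ts'
    with y ∈? leaves c' | y' ∈? leaves c'
  ... | yes y∈c' | yes y'∈c' =
    ⇔.trans (LcaBelow-child U' c'∈ts' x∈c' y∈c' y'∈c')
      (⇔.trans (agree y∈c' y'∈c') (⇔.sym (LcaBelow-child U c∈ts (c'⊆c x∈c') (c'⊆c y∈c') (c'⊆c y'∈c'))))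
  ... | no y∉c' | yes y'∈c' = mk⇔
    (λ below → ⊥-elim (¬LcaBelow-inside U' c'∈ts' x∈c' y∈ts' y∉c' y'∈c' below))
    (λ below → ⊥-elim (¬LcaBelow-inside U c∈ts (c'⊆c x∈c') (ts'⊆ts y∈ts')
                         (outside-c' y∈ts' y∉c') (c'⊆c y'∈c') below))
  ... | _ | no y'∉c' = mk⇔
    (λ _ → LcaBelow-outside U c∈ts (c'⊆c x∈c') (outside-c' y'∈ts' y'∉c'))
    (λ _ → LcaBelow-outside U' c'∈ts' x∈c' y'∉c')

  data BinTree : Set where
    tip : Fin n → BinTree
    bin : BinTree → BinTree → BinTree

  toTree : BinTree → Tree (Fin n)
  toTree (tip a) = leaf a
  toTree (bin l r) = node (toTree l ∷ toTree r ∷ [])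

  leavesᵇ : BinTree → List (Fin n)
  leavesᵇ t = leaves (toTree t)

  toTree-Phylo : ∀ t → Phylo (toTree t)
  toTree-Phylo (tip _) = leafP
  toTree-Phylo (bin l r) = nodeP (s≤s (s≤s z≤n)) (toTree-Phylo l ∷ toTree-Phylo r ∷ [])

  Binary⇒BinTree : ∀ {T} → Binary T → Σ BinTree λ t → toTree t ≡ T
  Binary⇒BinTree leafB = tip _ , refl
  Binary⇒BinTree (nodeB {ts = _ ∷ _ ∷ []} refl (bl ∷ br ∷ []))
    with Binary⇒BinTree bl | Binary⇒BinTree br
  ... | l , refl | r , refl = bin l r , refl

  ∈-bin⁺ˡ : ∀ {l r x} → x ∈ leavesᵇ l → x ∈ leavesᵇ (bin l r)
  ∈-bin⁺ˡ {l} {r} = ∈-leavesL⁺ {ts = toTree l ∷ toTree r ∷ []} (here refl)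

  ∈-bin⁺ʳ : ∀ {l r x} → x ∈ leavesᵇ r → x ∈ leavesᵇ (bin l r)
  ∈-bin⁺ʳ {l} {r} = ∈-leavesL⁺ {ts = toTree l ∷ toTree r ∷ []} (there (here refl))

  ∈-bin⁻ : ∀ {l r x} → x ∈ leavesᵇ (bin l r) → x ∈ leavesᵇ l ⊎ x ∈ leavesᵇ r
  ∈-bin⁻ {l} {r} x∈lr with ∈-leavesL⁻ (toTree l ∷ toTree r ∷ []) x∈lr
  ... | _ , here refl , x∈l = inj₁ x∈l
  ... | _ , there (here refl) , x∈r = inj₂ x∈r

  Unique-bin⁻ : ∀ {l r} → Unique (leavesᵇ (bin l r)) →
                Unique (leavesᵇ l) × Unique (leavesᵇ r) × Disjoint (leavesᵇ l) (leavesᵇ r)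
  Unique-bin⁻ {l} {r} U with Unique-++⁻ (leavesᵇ l) U
  ... | Ul , Ur[] , disj = Ul , proj₁ (Unique-++⁻ (leavesᵇ r) Ur[]) ,
                           λ (x∈l , x∈r) → disj (x∈l , ∈-++⁺ˡ x∈r)

  Unique-bin⁺ : ∀ {l r} → Unique (leavesᵇ l) → Unique (leavesᵇ r) → Disjoint (leavesᵇ l) (leavesᵇ r) →
                Unique (leavesᵇ (bin l r))
  Unique-bin⁺ {r = r} Ul Ur disj =
    Uniqueₚ.++⁺ Ul (Uniqueₚ.++⁺ Ur [] λ ())
      λ (x∈l , x∈r[]) → disj (x∈l , subst (_ ∈_) (++-identityʳ (leavesᵇ r)) x∈r[])

  leafSet : BinTree → Subset n
  leafSet (tip a) = ⁅ a ⁆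
  leafSet (bin l r) = leafSet l ∪ leafSet r

  ∈-leafSet : ∀ t → x ∈ₛ leafSet t ⇔ x ∈ leavesᵇ t
  ∈-leafSet (tip a) = mk⇔
    (λ x∈a → here (Subsetₚ.x∈⁅y⁆⇒x≡y a x∈a))
    (λ where (here refl) → Subsetₚ.x∈⁅x⁆ a)
  ∈-leafSet (bin l r) = ⇔.trans Subsetₚ.∪⇔⊎ (mk⇔
    [ ∈-bin⁺ˡ {l} {r} ∘ to (∈-leafSet l) , ∈-bin⁺ʳ {l} {r} ∘ to (∈-leafSet r) ]′
    (Sum.map (from (∈-leafSet l)) (from (∈-leafSet r)) ∘ ∈-bin⁻ {l} {r}))

  leafSet-nonempty : ∀ t → Nonempty (leafSet t)
  leafSet-nonempty (tip a) = a , Subsetₚ.x∈⁅x⁆ a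
  leafSet-nonempty (bin l r) =
    let x , x∈l = leafSet-nonempty l in x , Subsetₚ.x∈p∪q⁺ (inj₁ x∈l)

  root-bipartition : ∀ {l r W} → Unique (leavesᵇ (bin l r)) → LeafSetIs (toTree (bin l r)) W →
                     IsBipartition W (leafSet l) (leafSet r)
  root-bipartition {l} {r} U W≡lr =
    leafSet-nonempty l , leafSet-nonempty r ,
    Subsetₚ.⊆-antisym (λ x∈l∩r → ⊥-elim (l#r (in-both x∈l∩r))) (λ x∈∅ → ⊥-elim (Subsetₚ.∉⊥ x∈∅)) ,
    Subsetₚ.⊆-antisym (from (W≡lr _) ∘ to (∈-leafSet (bin l r))) (from (∈-leafSet (bin l r)) ∘ to (W≡lr _))
    where
    l#r = proj₂ (proj₂ (Unique-bin⁻ {l} {r} U))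
    in-both : ∀ {x} → x ∈ₛ leafSet l ∩ leafSet r → x ∈ leavesᵇ l × x ∈ leavesᵇ r
    in-both x∈l∩r = let x∈l , x∈r = Subsetₚ.x∈p∩q⁻ _ _ x∈l∩r in
                    to (∈-leafSet l) x∈l , to (∈-leafSet r) x∈r

  module _ (σ : Colouring n) where

    HasColour : Tree (Fin n) → ℕ → Set
    HasColour T k = ∃ λ y → y ∈ leaves T × σ y ≡ k

    ClosestOfColour : Tree (Fin n) → Fin n → ℕ → Fin n → Set
    ClosestOfColour T x k z =
      z ∈ leaves T × σ z ≡ k × ∀ y' → y' ∈ leaves T → σ y' ≡ k → LcaBelow T x z y'

    closest-in-node : ∀ {k} → Unique (leavesL ts) → c ∈ ts → x ∈ leaves c →
                      HasColour (node ts) k → (HasColour c k → ∃ (ClosestOfColour c x k)) →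
                      ∃ (ClosestOfColour (node ts) x k)
    closest-in-node {ts = ts} {c = c} {x = x} {k = k} U c∈ts x∈c (y , y∈ts , σy≡k) closest-in-c
      with any? (λ y₀ → σ y₀ ≟ k) (leaves c)
    ... | no none =
      y , y∈ts , σy≡k ,
      λ y' _ σy'≡k → LcaBelow-outside U c∈ts x∈c (λ y'∈c → none (lose y'∈c σy'≡k))
    ... | yes some with closest-in-c (find some)
    ...   | z , z∈c , σz≡k , z-closest = z , ∈-leavesL⁺ c∈ts z∈c , σz≡k , closest
      where
      closest : ∀ y' → y' ∈ leavesL ts → σ y' ≡ k → LcaBelow (node ts) x z y'
      closest y' _ σy'≡k with y' ∈? leaves c
      ... | yes y'∈c = from (LcaBelow-child U c∈ts x∈c z∈c y'∈c) (z-closest y' y'∈c σy'≡k)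
      ... | no y'∉c = LcaBelow-outside U c∈ts x∈c y'∉c

    closest-of-colour : ∀ {k} t → Unique (leavesᵇ t) → x ∈ leavesᵇ t →
                        HasColour (toTree t) k → ∃ (ClosestOfColour (toTree t) x k)
    closest-of-colour (tip a) _ _ (y , y∈a , σy≡k) = y , y∈a , σy≡k , λ _ _ _ → LcaBelow-leaf
    closest-of-colour (bin l r) U x∈lr has-k with Unique-bin⁻ {l} {r} U | ∈-bin⁻ {l = l} {r} x∈lr
    ... | Ul , _ , _ | inj₁ x∈l =
      closest-in-node U (here refl) x∈l has-k (closest-of-colour l Ul x∈l)
    ... | _ , Ur , _ | inj₂ x∈r =
      closest-in-node U (there (here refl)) x∈r has-k (closest-of-colour r Ur x∈r)

  -- The restriction t|S: the tree spanned by the leaves in S, unary vertices suppressed.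
  record Restriction (t : BinTree) (S : Subset n) : Set where
    field
      tree : BinTree
      unique : Unique (leavesᵇ tree)
      leaves-restricted : ∀ {x} → x ∈ leavesᵇ tree ⇔ (x ∈ leavesᵇ t × x ∈ₛ S)
      LcaBelow-restricted : ∀ {x y y'} → x ∈ leavesᵇ tree → y ∈ leavesᵇ tree → y' ∈ leavesᵇ tree →
                            LcaBelow (toTree tree) x y y' ⇔ LcaBelow (toTree t) x y y'

  restrict-bin : ∀ {l r S} → Unique (leavesᵇ (bin l r)) →
                 Restriction l S → Restriction r S → Restriction (bin l r) S
  restrict-bin {l} {r} {S} U Rl Rr = record
    { tree = bin l' r'
    ; unique = U'
    ; leaves-restricted = mk⇔ restricted unrestricted
    ; LcaBelow-restricted = agree
    }
    where
    open Restriction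
    l' = tree Rl
    r' = tree Rr
    l#r = proj₂ (proj₂ (Unique-bin⁻ {l} {r} U))
    l'⊆l : leavesᵇ l' ⊆ leavesᵇ l
    l'⊆l x∈l' = proj₁ (to (leaves-restricted Rl) x∈l')
    r'⊆r : leavesᵇ r' ⊆ leavesᵇ r
    r'⊆r x∈r' = proj₁ (to (leaves-restricted Rr) x∈r')
    restricted : ∀ {x} → x ∈ leavesᵇ (bin l' r') → x ∈ leavesᵇ (bin l r) × x ∈ₛ S
    restricted x∈l'r' with ∈-bin⁻ {l'} {r'} x∈l'r'
    ... | inj₁ x∈l' = ∈-bin⁺ˡ {l} {r} (l'⊆l x∈l') , proj₂ (to (leaves-restricted Rl) x∈l')
    ... | inj₂ x∈r' = ∈-bin⁺ʳ {l} {r} (r'⊆r x∈r') , proj₂ (to (leaves-restricted Rr) x∈r')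
    unrestricted : ∀ {x} → x ∈ leavesᵇ (bin l r) × x ∈ₛ S → x ∈ leavesᵇ (bin l' r')
    unrestricted (x∈lr , x∈S) with ∈-bin⁻ {l} {r} x∈lr
    ... | inj₁ x∈l = ∈-bin⁺ˡ {l'} {r'} (from (leaves-restricted Rl) (x∈l , x∈S))
    ... | inj₂ x∈r = ∈-bin⁺ʳ {l'} {r'} (from (leaves-restricted Rr) (x∈r , x∈S))
    U' : Unique (leavesᵇ (bin l' r'))
    U' = Unique-bin⁺ {l'} {r'} (unique Rl) (unique Rr) (λ (x∈l' , x∈r') → l#r (l'⊆l x∈l' , r'⊆r x∈r'))
    l'r'⊆lr : leavesᵇ (bin l' r') ⊆ leavesᵇ (bin l r)
    l'r'⊆lr x∈l'r' = proj₁ (restricted x∈l'r')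
    agree : ∀ {x y y'} → x ∈ leavesᵇ (bin l' r') → y ∈ leavesᵇ (bin l' r') → y' ∈ leavesᵇ (bin l' r') →
            LcaBelow (toTree (bin l' r')) x y y' ⇔ LcaBelow (toTree (bin l r)) x y y'
    agree x∈l'r' with ∈-bin⁻ {l'} {r'} x∈l'r'
    ... | inj₁ x∈l' =
      LcaBelow-node-agree U U' (here refl) (here refl) x∈l' l'r'⊆lr l'⊆l
        (λ z∈l'r' z∉l' z∈l → [ z∉l' , (λ z∈r' → l#r (z∈l , r'⊆r z∈r')) ]′ (∈-bin⁻ {l'} {r'} z∈l'r'))
        (λ y∈l' y'∈l' → LcaBelow-restricted Rl x∈l' y∈l' y'∈l')
    ... | inj₂ x∈r' =
      LcaBelow-node-agree U U' (there (here refl)) (there (here refl)) x∈r' l'r'⊆lr r'⊆r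
        (λ z∈l'r' z∉r' z∈r → [ (λ z∈l' → l#r (l'⊆l z∈l' , z∈r)) , z∉r' ]′ (∈-bin⁻ {l'} {r'} z∈l'r'))
        (λ y∈r' y'∈r' → LcaBelow-restricted Rr x∈r' y∈r' y'∈r')

  restrict-child : ∀ {l r c S} → Unique (leavesᵇ (bin l r)) → toTree c ∈ toTree l ∷ toTree r ∷ [] →
                   (∀ {x} → x ∈ leavesᵇ (bin l r) → x ∈ₛ S → x ∈ leavesᵇ c) →
                   Restriction c S → Restriction (bin l r) S
  restrict-child {l} {r} {c} {S} U c∈lr S⊆c Rc = record
    { tree = tree Rc
    ; unique = unique Rc
    ; leaves-restricted = mk⇔
        (λ x∈c' → let x∈c , x∈S = to (leaves-restricted Rc) x∈c' in ∈-leavesL⁺ c∈lr x∈c , x∈S)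
        (λ (x∈lr , x∈S) → from (leaves-restricted Rc) (S⊆c x∈lr x∈S , x∈S))
    ; LcaBelow-restricted = λ x∈c' y∈c' y'∈c' →
        ⇔.trans (LcaBelow-restricted Rc x∈c' y∈c' y'∈c')
                (⇔.sym (LcaBelow-child U c∈lr (c'⊆c x∈c') (c'⊆c y∈c') (c'⊆c y'∈c')))
    }
    where
    open Restriction
    c'⊆c : leavesᵇ (tree Rc) ⊆ leavesᵇ c
    c'⊆c x∈c' = proj₁ (to (leaves-restricted Rc) x∈c')

  restrict : ∀ t → Unique (leavesᵇ t) → ∀ S → (∃ λ x → x ∈ leavesᵇ t × x ∈ₛ S) → Restriction t S
  restrict (tip a) U S (_ , here refl , a∈S) = record
    { tree = tip a
    ; unique = U
    ; leaves-restricted = mk⇔ (λ where (here refl) → here refl , a∈S) proj₁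
    ; LcaBelow-restricted = λ _ _ _ → ⇔.refl
    }
  restrict (bin l r) U S (x , x∈lr , x∈S)
    with Unique-bin⁻ {l} {r} U | any? (_∈ₛ? S) (leavesᵇ l) | any? (_∈ₛ? S) (leavesᵇ r)
  ... | Ul , Ur , _ | yes S∩l | yes S∩r =
    restrict-bin {l} {r} U (restrict l Ul S (find S∩l)) (restrict r Ur S (find S∩r))
  ... | Ul , _ , _ | yes S∩l | no S∌r =
    restrict-child {l} {r} {l} U (here refl)
      (λ z∈lr z∈S → [ (λ z∈l → z∈l) , (λ z∈r → ⊥-elim (S∌r (lose z∈r z∈S))) ]′ (∈-bin⁻ {l} {r} z∈lr))
      (restrict l Ul S (find S∩l))
  ... | _ , Ur , _ | no S∌l | yes S∩r =
    restrict-child {l} {r} {r} U (there (here refl))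
      (λ z∈lr z∈S → [ (λ z∈l → ⊥-elim (S∌l (lose z∈l z∈S))) , (λ z∈r → z∈r) ]′ (∈-bin⁻ {l} {r} z∈lr))
      (restrict r Ur S (find S∩r))
  ... | _ | no S∌l | no S∌r = ⊥-elim $
    [ (λ x∈l → S∌l (lose x∈l x∈S)) , (λ x∈r → S∌r (lose x∈r x∈S)) ]′ (∈-bin⁻ {l} {r} x∈lr)

  PartsDisjoint : List (Subset n) → Set
  PartsDisjoint 𝒫 = ∀ P Q x → P ∈ 𝒫 → Q ∈ 𝒫 → x ∈ₛ P → x ∈ₛ Q → P ≡ Q

  leaf-or-child : ∀ t → x ∈ leaves t → (∃ λ z → t ≡ leaf z) ⊎ (∃ λ c → c ∈ children t × x ∈ leaves c)
  leaf-or-child (leaf z) _ = inj₁ (z , refl)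
  leaf-or-child (node ts) x∈ts = inj₂ (∈-leavesL⁻ ts x∈ts)

  child⇒≼ : ∀ t → c ∈ children t → c ≼ t
  child⇒≼ (node _) c∈ts = ≼-child ≼-refl c∈ts

  module RootPartition {W : Subset n} {𝒫 : List (Subset n)} {T : Tree (Fin n)}
                       (T∈𝒯 : InTW W 𝒫 T) (disjoint : PartsDisjoint 𝒫) where

    private
      variable
        P : Subset n
        w : Tree (Fin n)
        b a' : Fin n

    W⇔T : ∀ x → x ∈ₛ W ⇔ x ∈ leaves T
    W⇔T = proj₂ (proj₂ (proj₁ T∈𝒯))

    child-leafSet : c ∈ children T → P ∈ 𝒫 → a ∈ₛ P → a ∈ leaves c → LeafSetIs c P
    child-leafSet c∈T P∈𝒫 a∈P a∈c with All.lookup (proj₁ (proj₂ T∈𝒯)) c∈T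
    ... | Q , Q∈𝒫 , c≡Q with disjoint _ Q _ P∈𝒫 Q∈𝒫 a∈P (from (c≡Q _) a∈c)
    ...   | refl = c≡Q

    part-separated⇒root : P ∈ 𝒫 → a ∈ₛ P → b ∉ₛ P → w ≼ T → a ∈ leaves w → b ∈ leaves w → w ≡ T
    part-separated⇒root P∈𝒫 a∈P b∉P w≼T a∈w b∈w with ≼-inv w≼T
    ... | inj₁ w≡T = w≡T
    ... | inj₂ (c , c∈T , w≼c) =
      ⊥-elim (b∉P (from (child-leafSet c∈T P∈𝒫 a∈P (≼-leaves w≼c a∈w) _) (≼-leaves w≼c b∈w)))

    ¬BestMatch-colour-in-part : (σ : Colouring n) → P ∈ 𝒫 → a ∈ₛ P → b ∉ₛ P →
                                a' ∈ₛ P → a' ∈ₛ W → σ a' ≡ σ b → ¬ BestMatch σ T a b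
    ¬BestMatch-colour-in-part {a = a} {b = b} σ P∈𝒫 a∈P b∉P a'∈P a'∈W σa'≡σb (a∈T , b∈T , _ , closest)
      with leaf-or-child T a∈T
    ... | inj₁ (z , refl) with a∈T | b∈T
    ...   | here refl | here refl = b∉P a∈P
    ¬BestMatch-colour-in-part {a' = a'} σ P∈𝒫 a∈P b∉P a'∈P a'∈W σa'≡σb (a∈T , b∈T , _ , closest)
      | inj₂ (c , c∈T , a∈c) =
      let a'∈T = to (W⇔T _) a'∈W
          c≡P = child-leafSet c∈T P∈𝒫 a∈P a∈c
          v , (v≼T , a∈v , a'∈v , v-least) = lca T (proj₁ (proj₂ (proj₁ T∈𝒯))) a∈T a'∈T
          T-lca : IsLca T T _ _
          T-lca = ≼-refl , a∈T , b∈T , λ w w≼T a∈w b∈w →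
                  subst (T ≼_) (sym (part-separated⇒root P∈𝒫 a∈P b∉P w≼T a∈w b∈w)) ≼-refl
          T≼v = closest a' a'∈T σa'≡σb T v T-lca (v≼T , a∈v , a'∈v , v-least)
          v≼c = v-least c (child⇒≼ T c∈T) a∈c (to (c≡P a') a'∈P)
      in b∉P (from (c≡P _) (≼-leaves v≼c (≼-leaves T≼v b∈T)))

    BestMatch-colour-absent : (σ : Colouring n) → P ∈ 𝒫 → a ∈ₛ P → a ∈ₛ W → b ∈ₛ W → σ a ≢ σ b →
                              (∀ y' → y' ∈ₛ W → σ y' ≡ σ b → y' ∉ₛ P) → BestMatch σ T a b
    BestMatch-colour-absent σ P∈𝒫 a∈P a∈W b∈W σa≢σb colour-absent =
      to (W⇔T _) a∈W , to (W⇔T _) b∈W , σa≢σb ,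
      λ y' y'∈T σy'≡σb u v (u≼T , _) (v≼T , a∈v , y'∈v , _) →
        let y'∉P = colour-absent y' (from (W⇔T y') y'∈T) σy'≡σb
        in subst (u ≼_) (sym (part-separated⇒root P∈𝒫 a∈P y'∉P v≼T a∈v y'∈v)) u≼T

  module Bipartition {W A B : Subset n} (bip : IsBipartition W A B) where

    private
      A∩B≡∅ = proj₁ (proj₂ (proj₂ bip))
      A∪B≡W = proj₂ (proj₂ (proj₂ bip))

    A⊆W : A ⊆ₛ W
    A⊆W x∈A = subst (_ ∈ₛ_) A∪B≡W (Subsetₚ.x∈p∪q⁺ (inj₁ x∈A))

    B⊆W : B ⊆ₛ W
    B⊆W x∈B = subst (_ ∈ₛ_) A∪B≡W (Subsetₚ.x∈p∪q⁺ (inj₂ x∈B))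

    W⊆A∪B : x ∈ₛ W → x ∈ₛ A ⊎ x ∈ₛ B
    W⊆A∪B x∈W = Subsetₚ.x∈p∪q⁻ A B (subst (_ ∈ₛ_) (sym A∪B≡W) x∈W)

    A#B : x ∈ₛ A → x ∉ₛ B
    A#B x∈A x∈B = Subsetₚ.∉⊥ (subst (_ ∈ₛ_) A∩B≡∅ (Subsetₚ.x∈p∩q⁺ (x∈A , x∈B)))

    parts-disjoint : PartsDisjoint (A ∷ B ∷ [])
    parts-disjoint _ _ _ (here refl) (here refl) _ _ = refl
    parts-disjoint _ _ _ (here refl) (there (here refl)) x∈A x∈B = ⊥-elim (A#B x∈A x∈B)
    parts-disjoint _ _ _ (there (here refl)) (here refl) x∈B x∈A = ⊥-elim (A#B x∈A x∈B)
    parts-disjoint _ _ _ (there (here refl)) (there (here refl)) _ _ = refl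

    swap : IsBipartition W B A
    swap = proj₁ (proj₂ bip) , proj₁ bip ,
           trans (Subsetₚ.∩-comm B A) A∩B≡∅ , trans (Subsetₚ.∪-comm B A) A∪B≡W

  leaf-has-no-bipartition : ∀ {z W A B} → LeafSetIs (leaf z) W → ¬ IsBipartition W A B
  leaf-has-no-bipartition W≡z bip@((x , x∈A) , (y , y∈B) , _)
    with to (W≡z x) (Bipartition.A⊆W bip x∈A) | to (W≡z y) (Bipartition.B⊆W bip y∈B)
  ... | here refl | here refl = Bipartition.A#B bip x∈A y∈B

  bin∈𝒯 : ∀ {l r W X Y} → Unique (leavesᵇ (bin l r)) → LeafSetIs (toTree (bin l r)) W →
          LeafSetIs (toTree l) X → LeafSetIs (toTree r) Y → InTW W (X ∷ Y ∷ []) (toTree (bin l r))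
  bin∈𝒯 {l} {r} {X = X} {Y} U W≡lr X≡l Y≡r =
    (toTree-Phylo (bin l r) , U , W≡lr) ,
    ((X , here refl , X≡l) ∷ (Y , there (here refl) , Y≡r) ∷ []) ,
    ((toTree l , here refl , X≡l) ∷ (toTree r , there (here refl) , Y≡r) ∷ [])

  module Consistency (σ : Colouring n) where

    private
      variable
        G G' : Graph n
        W X Y A B : Subset n
        𝒫 : List (Subset n)

    Explains : Graph n → Subset n → Tree (Fin n) → Set
    Explains G W T = ∀ x y → x ∈ₛ W → y ∈ₛ W → (G x y ≡ true ⇔ BestMatch σ T x y)

    record ExplainedOn (G : Graph n) (W : Subset n) : Set where
      field
        tree : BinTree
        unique : Unique (leavesᵇ tree)
        leafSet≡ : LeafSetIs (toTree tree) W
        explains : Explains G W (toTree tree)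

    NoEdits : Graph n → Subset n → List (Subset n) → Set
    NoEdits G W 𝒫 = ∀ a b → ¬ UW σ G W 𝒫 a b

    CrossArcs : Graph n → Subset n → Subset n → Set
    CrossArcs G X Y = ∀ a b → a ∈ₛ X → b ∈ₛ Y →
      (G a b ≡ true ⇔ (σ a ≢ σ b × ∀ a' → a' ∈ₛ X → σ a' ≢ σ b))

    OutArcsToNewColours : Graph n → Subset n → Subset n → Set
    OutArcsToNewColours G W X = ∀ x z → x ∈ₛ X → z ∈ₛ W → z ∉ₛ X → G x z ≡ true →
                                ∀ a' → a' ∈ₛ X → σ a' ≢ σ z

    ExplainedOn-cong : (∀ a b → G' a b ≡ G a b) → ExplainedOn G W → ExplainedOn G' W
    ExplainedOn-cong G'≗G E = record
      { ExplainedOn E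
      ; explains = λ x y x∈W y∈W →
          ⇔.trans (mk⇔ (trans (sym (G'≗G x y))) (trans (G'≗G x y))) (explains x y x∈W y∈W)
      }
      where open ExplainedOn E

    arc⇒colours-differ : ExplainedOn G W → a ∈ₛ W → x ∈ₛ W → G a x ≡ true → σ a ≢ σ x
    arc⇒colours-differ E a∈W x∈W arc = proj₁ (proj₂ (proj₂ (to (ExplainedOn.explains E _ _ a∈W x∈W) arc)))

    explained⇒NoEdits : ∀ {T} → InTW W 𝒫 T → Explains G W T → NoEdits G W 𝒫
    explained⇒NoEdits T∈𝒯 E a b (a∈W , b∈W , in-every-U) with in-every-U _ T∈𝒯
    ... | inj₁ (arc , ¬bm) = ¬bm (to (E a b a∈W b∈W) arc)
    ... | inj₂ (no-arc , bm) with () ← trans (sym (from (E a b a∈W b∈W) bm)) no-arc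

    cost-zero⇒NoEdits : HasCost σ G W 𝒫 0 → NoEdits G W 𝒫
    cost-zero⇒NoEdits ([] , _ , _ , U≡[]) a b ab∈U with () ← from (U≡[] a b) ab∈U

    module _ {G W X} (E : ExplainedOn G W) (X⊆W : X ⊆ₛ W) (out-arcs : OutArcsToNewColours G W X)
             (R : Restriction (ExplainedOn.tree E) X) where

      private
        module E = ExplainedOn E
        module R = Restriction R
        T = toTree E.tree
        T' = toTree R.tree

        X⊆T : x ∈ₛ X → x ∈ leaves T
        X⊆T x∈X = to (E.leafSet≡ _) (X⊆W x∈X)

        X⊆T' : x ∈ₛ X → x ∈ leaves T'
        X⊆T' x∈X = from R.leaves-restricted (X⊆T x∈X , x∈X)

        -- For y' ∉ X compare with the leaf z of colour σ y closest to x in T: x → z is an arc,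
        -- so z ∈ X because σ y occurs in X, and lca(x , y) ⪯ lca(x , z) ⪯ lca(x , y').
        closest-in-T : x ∈ₛ X → y ∈ₛ X → σ x ≢ σ y →
                       (∀ y' → y' ∈ leaves T' → σ y' ≡ σ y → LcaBelow T' x y y') →
                       ∀ y' → y' ∈ leaves T → σ y' ≡ σ y → LcaBelow T x y y'
        closest-in-T {x} {y} x∈X y∈X σx≢σy closest-in-T' y' y'∈T σy'≡σy with y' ∈ₛ? X
        ... | yes y'∈X = to (R.LcaBelow-restricted (X⊆T' x∈X) (X⊆T' y∈X) (X⊆T' y'∈X))
                            (closest-in-T' y' (X⊆T' y'∈X) σy'≡σy)
        ... | no _ with closest-of-colour σ E.tree E.unique (X⊆T x∈X) (y , X⊆T y∈X , refl)
        ...   | z , z∈T , σz≡σy , z-closest =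
          LcaBelow-trans E.unique (X⊆T x∈X) z∈T y≤z (z-closest y' y'∈T σy'≡σy)
          where
          z∈W = from (E.leafSet≡ z) z∈T
          x→z : G x z ≡ true
          x→z = from (E.explains x z (X⊆W x∈X) z∈W)
                  (X⊆T x∈X , z∈T , (λ σx≡σz → σx≢σy (trans σx≡σz σz≡σy)) ,
                   λ y'' y''∈T σy''≡σz → z-closest y'' y''∈T (trans σy''≡σz σz≡σy))
          z∈X : z ∈ₛ X
          z∈X with z ∈ₛ? X
          ... | yes z∈X = z∈X
          ... | no z∉X = ⊥-elim (out-arcs x z x∈X z∈W z∉X x→z y y∈X (sym σz≡σy))
          y≤z : LcaBelow T x y z
          y≤z = to (R.LcaBelow-restricted (X⊆T' x∈X) (X⊆T' y∈X) (X⊆T' z∈X))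
                   (closest-in-T' z (X⊆T' z∈X) σz≡σy)

      BestMatch-restriction : x ∈ₛ X → y ∈ₛ X → BestMatch σ T x y ⇔ BestMatch σ T' x y
      BestMatch-restriction x∈X y∈X = mk⇔
        (λ (_ , _ , σx≢σy , closest) → X⊆T' x∈X , X⊆T' y∈X , σx≢σy ,
          λ y' y'∈T' σy'≡σy →
            from (R.LcaBelow-restricted (X⊆T' x∈X) (X⊆T' y∈X) y'∈T')
                 (closest y' (X⊆T (proj₂ (to R.leaves-restricted y'∈T'))) σy'≡σy))
        (λ (_ , _ , σx≢σy , closest) → X⊆T x∈X , X⊆T y∈X , σx≢σy ,
          closest-in-T x∈X y∈X σx≢σy closest)

    ExplainedOn-restrict : X ⊆ₛ W → Nonempty X → OutArcsToNewColours G W X →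
                           ExplainedOn G W → ExplainedOn G X
    ExplainedOn-restrict {X} X⊆W (x₀ , x₀∈X) out-arcs E = record
      { tree = R.tree
      ; unique = R.unique
      ; leafSet≡ = λ x → mk⇔ (λ x∈X → from R.leaves-restricted (X⊆T x∈X , x∈X))
                             (λ x∈T' → proj₂ (to R.leaves-restricted x∈T'))
      ; explains = λ x y x∈X y∈X → ⇔.trans (E.explains x y (X⊆W x∈X) (X⊆W y∈X))
                                           (BestMatch-restriction E X⊆W out-arcs restriction x∈X y∈X)
      }
      where
      module E = ExplainedOn E
      X⊆T : ∀ {x} → x ∈ₛ X → x ∈ leavesᵇ E.tree
      X⊆T x∈X = to (E.leafSet≡ _) (X⊆W x∈X)
      restriction = restrict E.tree E.unique X (x₀ , X⊆T x₀∈X , x₀∈X)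
      module R = Restriction restriction

    NoEdits⇒cost-zero : NoEdits G W 𝒫 → HasCost σ G W 𝒫 0
    NoEdits⇒cost-zero no-edits = [] , [] , refl , λ a b → mk⇔ (λ ()) (λ ab∈U → ⊥-elim (no-edits a b ab∈U))

    module _ {G W 𝒫} (no-edits : NoEdits G W 𝒫) (disjoint : PartsDisjoint 𝒫)
             {P a b} (P∈𝒫 : P ∈ 𝒫) (a∈P : a ∈ₛ P) (a∈W : a ∈ₛ W) (b∈W : b ∈ₛ W) (b∉P : b ∉ₛ P) where

      arc⇒colour-absent-in-part : G a b ≡ true → ∀ a' → a' ∈ₛ P → a' ∈ₛ W → σ a' ≢ σ b
      arc⇒colour-absent-in-part arc a' a'∈P a'∈W σa'≡σb = no-edits a b (a∈W , b∈W , λ _ T∈𝒯 →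
        inj₁ (arc , RootPartition.¬BestMatch-colour-in-part T∈𝒯 disjoint σ P∈𝒫 a∈P b∉P a'∈P a'∈W σa'≡σb))

      colour-absent⇒arc : σ a ≢ σ b → (∀ y' → y' ∈ₛ W → σ y' ≡ σ b → y' ∉ₛ P) → G a b ≡ true
      colour-absent⇒arc σa≢σb absent with G a b ≟ᵇ true
      ... | yes arc = arc
      ... | no ¬arc = ⊥-elim (no-edits a b (a∈W , b∈W , λ _ T∈𝒯 →
        inj₂ (¬-not ¬arc , RootPartition.BestMatch-colour-absent T∈𝒯 disjoint σ P∈𝒫 a∈P a∈W b∈W σa≢σb absent)))

    NoEdits⇒CrossArcs : ∀ {P Q} → ExplainedOn G W → NoEdits G W 𝒫 → PartsDisjoint 𝒫 → P ∈ 𝒫 →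
                        P ⊆ₛ W → Q ⊆ₛ W → (∀ {x} → x ∈ₛ P → x ∉ₛ Q) → CrossArcs G P Q
    NoEdits⇒CrossArcs E no-edits disjoint P∈𝒫 P⊆W Q⊆W P#Q a b a∈P b∈Q = mk⇔
      (λ arc → arc⇒colours-differ E a∈W b∈W arc ,
               λ a' a'∈P → arc⇒colour-absent-in-part no-edits disjoint P∈𝒫 a∈P a∈W b∈W b∉P arc a' a'∈P (P⊆W a'∈P))
      (λ (σa≢σb , absent) → colour-absent⇒arc no-edits disjoint P∈𝒫 a∈P a∈W b∈W b∉P σa≢σb
               λ y' _ σy'≡σb y'∈P → absent y' y'∈P σy'≡σb)
      where
      a∈W = P⊆W a∈P
      b∈W = Q⊆W b∈Q
      b∉P = λ b∈P → P#Q b∈P b∈Q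

    rule1⇒NoEdits : ExplainedOn G W → IsBipartition W A B → Rule1 σ G W A B → NoEdits G W (A ∷ B ∷ [])
    rule1⇒NoEdits record { tree = tip _ ; leafSet≡ = W≡z } bip _ = ⊥-elim (leaf-has-no-bipartition W≡z bip)
    rule1⇒NoEdits {G} {W} record { tree = bin l r ; unique = U ; leafSet≡ = W≡lr ; explains = explains }
                  _ (k , cost-k , minimal) =
      -- the root split of the explaining tree is a bipartition of UR-cost 0
      cost-zero⇒NoEdits (subst (HasCost σ G W _) (n≤0⇒n≡0 k≤0) cost-k)
      where
      k≤0 = minimal (leafSet l) (leafSet r) (root-bipartition {l} {r} U W≡lr) 0
              (NoEdits⇒cost-zero (explained⇒NoEdits
                (bin∈𝒯 {l} {r} U W≡lr (λ x → ∈-leafSet l) (λ x → ∈-leafSet r)) explains))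

    coarse-graining-separates : ∀ {𝒱} → IsBipartition W X Y → IsAhoComponents σ G W 𝒱 →
                                All (λ P → P ⊆ₛ X ⊎ P ⊆ₛ Y) 𝒱 →
                                x ∈ₛ X → y ∈ₛ Y → ¬ AhoConnected σ G W x y
    coarse-graining-separates bip (_ , components) coarse x∈X y∈Y connected
      with from (components _ _ (Bipartition.A⊆W bip x∈X) (Bipartition.B⊆W bip y∈Y)) connected
    ... | P , P∈𝒱 , x∈P , y∈P with All.lookup coarse P∈𝒱
    ...   | inj₁ P⊆X = Bipartition.A#B bip (P⊆X y∈P) y∈Y
    ...   | inj₂ P⊆Y = Bipartition.A#B bip x∈X (P⊆Y x∈P)

    -- If some a' ∈ X had the colour of b, that colour would be absent from the component P ⊆ X
    -- of a, so a → a' is an arc too; then ab|a' ∈ F puts b and a' into one Aho component.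
    aho-coarse-graining⇒CrossArcs : ∀ {𝒱} → ExplainedOn G W → IsBipartition W X Y →
                                    IsAhoComponents σ G W 𝒱 → NoEdits G W 𝒱 →
                                    All (λ P → P ⊆ₛ X ⊎ P ⊆ₛ Y) 𝒱 → CrossArcs G X Y
    aho-coarse-graining⇒CrossArcs {G} {W} {X} E bip aho@((_ , cover , disjoint) , _) no-edits coarse
                                  a b a∈X b∈Y with cover a (Bipartition.A⊆W bip a∈X)
    ... | P , P∈𝒱 , a∈P = mk⇔ arc⇒cross cross⇒arc
      where
      open Bipartition bip renaming (A⊆W to X⊆W; B⊆W to Y⊆W; A#B to X#Y)
      a∈W = X⊆W a∈X
      b∈W = Y⊆W b∈Y
      P⊆X : P ⊆ₛ X
      P⊆X with All.lookup coarse P∈𝒱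
      ... | inj₁ P⊆X = P⊆X
      ... | inj₂ P⊆Y = ⊥-elim (X#Y a∈X (P⊆Y a∈P))
      b∉P = λ b∈P → X#Y (P⊆X b∈P) b∈Y

      arc⇒cross : G a b ≡ true → σ a ≢ σ b × ∀ a' → a' ∈ₛ X → σ a' ≢ σ b
      arc⇒cross arc = σa≢σb , colour-absent-in-X
        where
        σa≢σb = arc⇒colours-differ E a∈W b∈W arc
        colour-absent-in-X : ∀ a' → a' ∈ₛ X → σ a' ≢ σ b
        colour-absent-in-X a' a'∈X σa'≡σb with Finₚ.any? (λ y → y ∈ₛ? P ×-dec σ y ≟ σ b)
        ... | yes (y , y∈P , σy≡σb) =
          arc⇒colour-absent-in-part no-edits disjoint P∈𝒱 a∈P a∈W b∈W b∉P arc y y∈P (X⊆W (P⊆X y∈P)) σy≡σb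
        ... | no colour-not-in-P = coarse-graining-separates bip aho coarse a'∈X b∈Y (aho-edge ◅ ε)
          where
          a'∈W = X⊆W a'∈X
          a→a' : G a a' ≡ true
          a→a' = colour-absent⇒arc no-edits disjoint P∈𝒱 a∈P a∈W a'∈W
                   (λ a'∈P → colour-not-in-P (a' , a'∈P , σa'≡σb))
                   (λ σa≡σa' → σa≢σb (trans σa≡σa' σa'≡σb))
                   (λ y' _ σy'≡σa' y'∈P → colour-not-in-P (y' , y'∈P , trans σy'≡σa' σa'≡σb))
          aho-edge : AhoEdge σ G W a' b
          aho-edge = a'∈W , b∈W , a , a∈W , inj₂ (inj₂
            (a∈W , b∈W , a'∈W , σa≢σb , sym σa'≡σb , (λ { refl → X#Y a'∈X b∈Y }) , arc , a→a'))

      cross⇒arc : σ a ≢ σ b × (∀ a' → a' ∈ₛ X → σ a' ≢ σ b) → G a b ≡ true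
      cross⇒arc (σa≢σb , absent) = colour-absent⇒arc no-edits disjoint P∈𝒱 a∈P a∈W b∈W b∉P σa≢σb
        λ y' _ σy'≡σb y'∈P → absent y' (P⊆X y'∈P) σy'≡σb

    rule⇒CrossArcs : ExplainedOn G W → IsBipartition W A B → Rule1 σ G W A B ⊎ Rule2 σ G W A B →
                     CrossArcs G A B × CrossArcs G B A
    rule⇒CrossArcs E bip (inj₁ rule1) =
      NoEdits⇒CrossArcs E no-edits parts-disjoint (here refl) A⊆W B⊆W A#B ,
      NoEdits⇒CrossArcs E no-edits parts-disjoint (there (here refl)) B⊆W A⊆W (λ x∈B x∈A → A#B x∈A x∈B)
      where
      open Bipartition bip
      no-edits = rule1⇒NoEdits E bip rule1
    rule⇒CrossArcs E bip (inj₂ (_ , 𝒱 , components , cost-zero , coarse)) =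
      aho-coarse-graining⇒CrossArcs E bip components no-edits coarse ,
      aho-coarse-graining⇒CrossArcs E (Bipartition.swap bip) components no-edits (All.map Sum.swap coarse)
      where
      no-edits = cost-zero⇒NoEdits cost-zero

    CrossArcs⇒OutArcsToNewColours : IsBipartition W A B → CrossArcs G A B → OutArcsToNewColours G W A
    CrossArcs⇒OutArcsToNewColours bip cross x z x∈A z∈W z∉A arc with Bipartition.W⊆A∪B bip z∈W
    ... | inj₁ z∈A = ⊥-elim (z∉A z∈A)
    ... | inj₂ z∈B = proj₂ (to (cross x z x∈A z∈B) arc)

    colour-absent-in-leaves : ∀ {T a b} → LeafSetIs T X →
                              (σ a ≢ σ b × ∀ a' → a' ∈ₛ X → σ a' ≢ σ b) ⇔
                              (σ a ≢ σ b × ∀ y' → y' ∈ leaves T → σ y' ≢ σ b)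
    colour-absent-in-leaves X≡T = mk⇔
      (λ (σa≢σb , absent) → σa≢σb , λ y' y'∈T → absent y' (from (X≡T y') y'∈T))
      (λ (σa≢σb , absent) → σa≢σb , λ a' a'∈X → absent a' (to (X≡T a') a'∈X))

    ExplainedOn-join : IsBipartition W A B → CrossArcs G A B → CrossArcs G B A →
                       ExplainedOn G A → ExplainedOn G B → ExplainedOn G W
    ExplainedOn-join {W} {A} {B} {G} bip A→B B→A EA EB = record
      { tree = bin l r
      ; unique = U
      ; leafSet≡ = λ x → mk⇔
          (λ x∈W → [ (λ x∈A → ∈-bin⁺ˡ {l} {r} (A⊆l x∈A)) , (λ x∈B → ∈-bin⁺ʳ {l} {r} (B⊆r x∈B)) ]′
                   (W⊆A∪B x∈W))
          (λ x∈lr → [ (λ x∈l → A⊆W (from (EA.leafSet≡ _) x∈l)) , (λ x∈r → B⊆W (from (EB.leafSet≡ _) x∈r)) ]′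
                    (∈-bin⁻ {l} {r} x∈lr))
      ; explains = explains
      }
      where
      open Bipartition bip
      module EA = ExplainedOn EA
      module EB = ExplainedOn EB
      l = EA.tree
      r = EB.tree
      A⊆l : ∀ {x} → x ∈ₛ A → x ∈ leavesᵇ l
      A⊆l x∈A = to (EA.leafSet≡ _) x∈A
      B⊆r : ∀ {x} → x ∈ₛ B → x ∈ leavesᵇ r
      B⊆r x∈B = to (EB.leafSet≡ _) x∈B
      U : Unique (leavesᵇ (bin l r))
      U = Unique-bin⁺ {l} {r} EA.unique EB.unique
            (λ (x∈l , x∈r) → A#B (from (EA.leafSet≡ _) x∈l) (from (EB.leafSet≡ _) x∈r))
      explains : Explains G W (toTree (bin l r))
      explains x y x∈W y∈W with W⊆A∪B x∈W | W⊆A∪B y∈W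
      ... | inj₁ x∈A | inj₁ y∈A =
        ⇔.trans (EA.explains x y x∈A y∈A) (⇔.sym (BestMatch-child U (here refl) (A⊆l x∈A) σ (A⊆l y∈A)))
      ... | inj₂ x∈B | inj₂ y∈B =
        ⇔.trans (EB.explains x y x∈B y∈B) (⇔.sym (BestMatch-child U (there (here refl)) (B⊆r x∈B) σ (B⊆r y∈B)))
      ... | inj₁ x∈A | inj₂ y∈B =
        ⇔.trans (A→B x y x∈A y∈B) (⇔.trans (colour-absent-in-leaves {T = toTree l} EA.leafSet≡)
          (⇔.sym (BestMatch-cross U (here refl) (A⊆l x∈A) σ (∈-bin⁺ʳ {l} {r} (B⊆r y∈B))
                    (λ y∈l → A#B (from (EA.leafSet≡ _) y∈l) y∈B))))
      ... | inj₂ x∈B | inj₁ y∈A =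
        ⇔.trans (B→A x y x∈B y∈A) (⇔.trans (colour-absent-in-leaves {T = toTree r} EB.leafSet≡)
          (⇔.sym (BestMatch-cross U (there (here refl)) (B⊆r x∈B) σ (∈-bin⁺ˡ {l} {r} (A⊆l y∈A))
                    (λ y∈r → A#B y∈A (from (EB.leafSet≡ _) y∈r)))))

    split-explained : IsBipartition W A B → CrossArcs G A B → CrossArcs G B A → ExplainedOn G W →
                      ExplainedOn G A × ExplainedOn G B × NoEdits G W (A ∷ B ∷ [])
    split-explained bip A→B B→A E =
      EA , EB , explained⇒NoEdits (bin∈𝒯 {EA.tree} {EB.tree} J.unique J.leafSet≡ EA.leafSet≡ EB.leafSet≡)
                                  J.explains
      where
      open Bipartition bip
      EA = ExplainedOn-restrict A⊆W (proj₁ bip) (CrossArcs⇒OutArcsToNewColours bip A→B) E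
      EB = ExplainedOn-restrict B⊆W (proj₁ (proj₂ bip)) (CrossArcs⇒OutArcsToNewColours swap B→A) E
      module EA = ExplainedOn EA
      module EB = ExplainedOn EB
      module J = ExplainedOn (ExplainedOn-join bip A→B B→A EA EB)

    run-preserves : Run σ G W G' → ExplainedOn G W → ∀ a b → G' a b ≡ G a b
    run-preserves (run-one _) _ _ _ = refl
    run-preserves {G} {W} (run-split {A = A} {B} {G₁} {G₂} _ bip rule edit run-A run-B) E a b =
      trans (G₃≗G₂ a b) (G₂≗G a b)
      where
      cross : CrossArcs G A B × CrossArcs G B A
      cross = rule⇒CrossArcs E bip rule
      parts : ExplainedOn G A × ExplainedOn G B × NoEdits G W (A ∷ B ∷ [])
      parts = split-explained bip (proj₁ cross) (proj₂ cross) E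
      G₁≗G : ∀ a b → G₁ a b ≡ G a b
      G₁≗G a b = proj₂ (edit a b) (proj₂ (proj₂ parts) a b)
      G₂≗G : ∀ a b → G₂ a b ≡ G a b
      G₂≗G a b = trans (run-preserves run-A (ExplainedOn-cong G₁≗G (proj₁ parts)) a b) (G₁≗G a b)
      G₃≗G₂ = run-preserves run-B (ExplainedOn-cong G₂≗G (proj₁ (proj₂ parts)))

theorem4 : ∀ {n : ℕ} (G : Graph n) (σ : Colouring n) →
           0 < n → Irreflexive G → ProperlyColoured G σ →
           BinaryExplainableBMG G σ →
           ∀ (G' : Graph n) → Run σ G ⊤ G' →
           ∀ (a b : Fin n) → G' a b ≡ G a b
-- Loop-freeness, proper colouring and 0 < n all follow from binary explainability.
theorem4 G σ _ _ _ (T , (_ , U , ⊤≡T) , binary , explains) G' run with Binary⇒BinTree binary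
... | t , refl = Consistency.run-preserves σ run
  record { tree = t ; unique = U ; leafSet≡ = ⊤≡T ; explains = λ x y _ _ → explains x y }
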